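{- Let $k$ be a field, $E=\{x_1,\ldots,x_n\}$ a finite set and $\mathcal A$ a set-arrangement on $E$. For each $A\in\mathcal A$ let $R_A\subseteq [\mathcal F(A),\mathcal F(A)]$ and $L_A=\mathcal F(A)/\langle R_A\rangle$. Let $\mathcal L=\mathcal F(E)/\langle R\rangle$, where $$R=\bigcup_{A\in\mathcal A}R_A\ \cup\ \{[x_i,x_j] : \{x_i,x_j\}\text{ is not a subset of any }A\in\mathcal A\}.$$ For $A\in\mathcal A$, let $\pi_A:\mathcal L\to L_A$ be the Lie homomorphism sending each $x\in A$ to $x$ and each $x\in E\setminus A$ to $0$, and let $s_A:L_A\to\mathcal L$ be the Lie homomorphism induced by the inclusion $A\subseteq E$. Let $\pi_A':\mathcal L'\to L_A'$ and $s_A':L_A'\to\mathcal L'$ be their restrictions to derived subalgebras, let $\pi=\bigoplus_{A\in\mathcal A}\pi_A':\mathcal L'\to\bigoplus_{A\in\mathcal A}L_A'$ and $I=\ker\pi$. Then $I=0$ if and only if $[x,s_A'(L_A')]=0$ in $\mathcal L$ for all $A\in\mathcal A$ and all $x\in E\setminus A$.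
   Context: All Lie algebras are over $k$. $\mathcal F(X)$ denotes the free Lie algebra on a set $X$, $\langle S\rangle$ the Lie ideal generated by $S$, and $L'=[L,L]$ the derived subalgebra of a Lie algebra $L$. A set-arrangement on a finite set $E$ is a set $\mathcal A$ of subsets of $E$ such that $|A|\ge 3$ for all $A\in\mathcal A$ and $|A\cap B|\le 1$ for all distinct $A,B\in\mathcal A$. The maps $\pi_A$ and $s_A$ are well defined and satisfy $\pi_A\circ s_A=\mathrm{id}_{L_A}$. -}

module Defs where

open import Level using (0ℓ)
open import Algebra.Bundles using (CommutativeRing)
open import Data.Nat using (ℕ; _≤_)
open import Data.Fin using (Fin)
open import Data.Fin.Subset using (Subset; _∈_; _∉_; _∩_; ∣_∣)
open import Data.Fin.Subset.Properties using (_∈?_)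
open import Data.List using (List; []; _∷_)
open import Data.Product using (Σ; ∃; _×_; _,_; proj₁)
open import Relation.Nullary using (¬_; yes; no; Dec)
open import Data.Empty using (⊥)
open import Relation.Binary.PropositionalEquality using (_≡_)

record Field : Set₁ where
  field
    commRing : CommutativeRing 0ℓ 0ℓ
  open CommutativeRing commRing public
  field
    1≉0     : ¬ (1# ≈ 0#)
    inverse : ∀ x → ¬ (x ≈ 0#) → ∃ λ y → x * y ≈ 1#

module _ (k : Field) where
  open Field k renaming (Carrier to K; _≈_ to _≈ₖ_; _+_ to _+ₖ_; _*_ to _*ₖ_)

  data Term (X : Set) : Set where
    gen   : X → Term X
    𝟎  : Term X
    _⊕_   : Term X → Term X → Term X
    neg   : Term X → Term X
    _●_   : K → Term X → Term X
    ⟦_,_⟧ : Term X → Term X → Term X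

  -- The Lie algebra F(X)/⟨Rl⟩ presented by generators X and relations Rl:
  -- the least congruence containing the k-vector-space axioms, bilinearity,
  -- alternation, Jacobi, and r ~ 0 for r ∈ Rl.
  -- With Rl empty this is the free Lie algebra F(X).
  data Eq {X : Set} (Rl : Term X → Set) : Term X → Term X → Set where
    refl'  : ∀ {u} → Eq Rl u u
    sym'   : ∀ {u v} → Eq Rl u v → Eq Rl v u
    trans' : ∀ {u v w} → Eq Rl u v → Eq Rl v w → Eq Rl u w
    ⊕-cong : ∀ {u u′ v v′} → Eq Rl u u′ → Eq Rl v v′ → Eq Rl (u ⊕ v) (u′ ⊕ v′)
    neg-cong : ∀ {u u′} → Eq Rl u u′ → Eq Rl (neg u) (neg u′)
    ●-cong : ∀ {a b u v} → a ≈ₖ b → Eq Rl u v → Eq Rl (a ● u) (b ● v)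
    br-cong : ∀ {u u′ v v′} → Eq Rl u u′ → Eq Rl v v′ → Eq Rl ⟦ u , v ⟧ ⟦ u′ , v′ ⟧
    ⊕-assoc : ∀ u v w → Eq Rl ((u ⊕ v) ⊕ w) (u ⊕ (v ⊕ w))
    ⊕-comm  : ∀ u v → Eq Rl (u ⊕ v) (v ⊕ u)
    ⊕-idˡ   : ∀ u → Eq Rl (𝟎 ⊕ u) u
    ⊕-invʳ  : ∀ u → Eq Rl (u ⊕ neg u) 𝟎
    ●-distribˡ : ∀ a u v → Eq Rl (a ● (u ⊕ v)) ((a ● u) ⊕ (a ● v))
    ●-distribʳ : ∀ a b u → Eq Rl ((a +ₖ b) ● u) ((a ● u) ⊕ (b ● u))
    ●-assoc    : ∀ a b u → Eq Rl ((a *ₖ b) ● u) (a ● (b ● u))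
    ●-id       : ∀ u → Eq Rl (1# ● u) u
    br-⊕ˡ : ∀ u v w → Eq Rl ⟦ u ⊕ v , w ⟧ (⟦ u , w ⟧ ⊕ ⟦ v , w ⟧)
    br-⊕ʳ : ∀ u v w → Eq Rl ⟦ u , v ⊕ w ⟧ (⟦ u , v ⟧ ⊕ ⟦ u , w ⟧)
    br-●ˡ : ∀ a u v → Eq Rl ⟦ a ● u , v ⟧ (a ● ⟦ u , v ⟧)
    br-●ʳ : ∀ a u v → Eq Rl ⟦ u , a ● v ⟧ (a ● ⟦ u , v ⟧)
    alt    : ∀ u → Eq Rl ⟦ u , u ⟧ 𝟎
    jacobi : ∀ u v w → Eq Rl ((⟦ u , ⟦ v , w ⟧ ⟧ ⊕ ⟦ v , ⟦ w , u ⟧ ⟧) ⊕ ⟦ w , ⟦ u , v ⟧ ⟧) 𝟎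
    rel    : ∀ {r} → Rl r → Eq Rl r 𝟎

  NoRel : {X : Set} → Term X → Set
  NoRel _ = ⊥

  sumBr : {X : Set} → List (Term X × Term X) → Term X
  sumBr []             = 𝟎
  sumBr ((a , b) ∷ ps) = ⟦ a , b ⟧ ⊕ sumBr ps

  Derived : {X : Set} → (Term X → Set) → Term X → Set
  Derived Rl u = Σ (List (Term _ × Term _)) λ ps → Eq Rl u (sumBr ps)

  subst : {X Y : Set} → (X → Term Y) → Term X → Term Y
  subst f (gen x)     = f x
  subst f 𝟎        = 𝟎
  subst f (u ⊕ v)     = subst f u ⊕ subst f v
  subst f (neg u)     = neg (subst f u)
  subst f (a ● u)     = a ● subst f u
  subst f ⟦ u , v ⟧   = ⟦ subst f u , subst f v ⟧

  module _ {n : ℕ} where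
    Gen : Subset n → Set
    Gen A = Σ (Fin n) λ x → x ∈ A

    sMap : (A : Subset n) → Term (Gen A) → Term (Fin n)
    sMap A = subst (λ x → gen (proj₁ x))

    πMap : (A : Subset n) → Term (Fin n) → Term (Gen A)
    πMap A = subst (λ x → proj x (x ∈? A))
      where
        proj : (x : Fin n) → Dec (x ∈ A) → Term (Gen A)
        proj x (yes p) = gen (x , p)
        proj x (no _)  = 𝟎

    IsSetArrangement : {m : ℕ} → (Fin m → Subset n) → Set
    IsSetArrangement {m} A =
      (∀ i → 3 ≤ ∣ A i ∣) × (∀ i j → ¬ (i ≡ j) → ∣ A i ∩ A j ∣ ≤ 1)

    data BigR {m : ℕ} (A : Fin m → Subset n)
              (RA : (i : Fin m) → Term (Gen (A i)) → Set) : Term (Fin n) → Set where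
      fromA : ∀ i r → RA i r → BigR A RA (sMap (A i) r)
      pairs : ∀ x y → ¬ (∃ λ i → (x ∈ A i) × (y ∈ A i)) → BigR A RA ⟦ gen x , gen y ⟧

-- For i ≠ j the generators of A i are sent by π j to pairwise commuting elements (A i ∩ A j has
-- at most one point), so π j ∘ s i kills L'(A i), while π i ∘ s i is the identity. Hence if I = 0,
-- then [x, s i v] = 0 for x ∉ A i, as all of its projections vanish. Conversely, if these brackets
-- vanish, then 𝓛' = Σ i s i (L'(A i)): the right-hand side contains every [x, y] (it lies in some
-- s i (L'(A i)), or is a relation), and it is stable under ad x for each generator x, hence under
-- every ad a by Jacobi. Applying π j to u = Σ i s i (w i) recovers w j, so π u = 0 forces u = 0.

module Submission where

open import Defs
open import Level using (0ℓ)
open import Algebra.Bundles using (AbelianGroup)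
import Algebra.Properties.AbelianGroup as AbelianGroupProperties
import Algebra.Properties.CommutativeMonoid.Sum as CommutativeMonoidSum
open import Data.Nat using (ℕ; zero; suc; _≤_; z≤n; s≤s)
open import Data.Nat.Properties using (≤-trans; ≤-<-trans; <⇒≱)
open import Data.Fin using (Fin; zero; suc; punchIn; _≟_)
open import Data.Fin.Properties using (punchInᵢ≢i; any?)
open import Data.Fin.Subset using (Subset; _∈_; _∉_; _∩_; ∣_∣)
open import Data.Fin.Subset.Properties using (_∈?_; x∈p∩q⁺; x∈p∧x≢y⇒x∈p-y; x∈p⇒∣p-x∣<∣p∣)
open import Data.List using (List; []; _∷_; _++_)
open import Data.Product using (Σ; _×_; _,_; proj₁)
open import Data.Vec.Functional as Vector using ()
open import Data.Vec.Properties.WithK using ([]=-irrelevant)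
open import Function using (_∘_)
open import Function.Bundles using (_⇔_; mk⇔)
open import Relation.Binary.PropositionalEquality using (_≡_; _≢_; refl; sym; trans; cong; cong₂)
open import Relation.Nullary using (¬_; yes; no; contradiction)
open import Relation.Nullary.Decidable using (_×-dec_)
import Relation.Binary.Reasoning.Setoid as SetoidReasoning

sum : (k : Field) {X : Set} {m : ℕ} → (Fin m → Term k X) → Term k X
sum k = Vector.foldr _⊕_ 𝟎

x∈p∧y∈p∧∣p∣≤1⇒x≡y : ∀ {n} {p : Subset n} {x y} → x ∈ p → y ∈ p → ∣ p ∣ ≤ 1 → x ≡ y
x∈p∧y∈p∧∣p∣≤1⇒x≡y {x = x} {y} x∈p y∈p ∣p∣≤1 with x ≟ y
... | yes x≡y = x≡y
... | no x≢y  = contradiction ∣p∣≤1 (<⇒≱ (≤-<-trans 1≤∣p-x∣ (x∈p⇒∣p-x∣<∣p∣ x∈p)))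
  where
  1≤∣p-x∣ = ≤-trans (s≤s z≤n) (x∈p⇒∣p-x∣<∣p∣ (x∈p∧x≢y⇒x∈p-y y∈p (x≢y ∘ sym)))

module Presentation (k : Field) {X : Set} (Rl : Term k X → Set) where

  open Field k using (-_; -‿inverseʳ; +-identityˡ)
    renaming (Carrier to K; _+_ to _+ₖ_; 0# to 0ₖ; 1# to 1ₖ; refl to ≈ₖ-refl)

  infix 4 _~_
  _~_ : Term k X → Term k X → Set
  _~_ = Eq k Rl

  abelianGroup : AbelianGroup 0ℓ 0ℓ
  abelianGroup = record
    { Carrier = Term k X ; _≈_ = _~_ ; _∙_ = _⊕_ ; ε = 𝟎 ; _⁻¹ = neg
    ; isAbelianGroup = record
      { isGroup = record
        { isMonoid = record
          { isSemigroup = record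
            { isMagma = record
              { isEquivalence = record { refl = refl' ; sym = sym' ; trans = trans' }
              ; ∙-cong = ⊕-cong }
            ; assoc = ⊕-assoc }
          ; identity = ⊕-idˡ , λ u → trans' (⊕-comm u 𝟎) (⊕-idˡ u) }
        ; inverse = (λ u → trans' (⊕-comm (neg u) u) (⊕-invʳ u)) , ⊕-invʳ
        ; ⁻¹-cong = neg-cong }
      ; comm = ⊕-comm } }

  open AbelianGroup abelianGroup using (commutativeMonoid; identityʳ)
  open AbelianGroup abelianGroup public using (setoid; reflexive)
  open AbelianGroupProperties abelianGroup using (identityʳ-unique; inverseʳ-unique; ⁻¹-involutive)
  open CommutativeMonoidSum commutativeMonoid public using (sum-cong-≋; ∑-distrib-+)
  open CommutativeMonoidSum commutativeMonoid using (sum-remove)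
  open SetoidReasoning setoid

  record IsAdditive (f : Term k X → Term k X) : Set where
    field
      ~-cong : ∀ {u v} → u ~ v → f u ~ f v
      ⊕-homo : ∀ u v → f (u ⊕ v) ~ (f u ⊕ f v)

    𝟎-homo : f 𝟎 ~ 𝟎
    𝟎-homo = identityʳ-unique (f 𝟎) (f 𝟎) (begin
      f 𝟎 ⊕ f 𝟎  ≈⟨ ⊕-homo 𝟎 𝟎 ⟨
      f (𝟎 ⊕ 𝟎)  ≈⟨ ~-cong (⊕-idˡ 𝟎) ⟩
      f 𝟎        ∎)

    neg-homo : ∀ u → f (neg u) ~ neg (f u)
    neg-homo u = inverseʳ-unique (f u) (f (neg u)) (begin
      f u ⊕ f (neg u)  ≈⟨ ⊕-homo u (neg u) ⟨
      f (u ⊕ neg u)    ≈⟨ ~-cong (⊕-invʳ u) ⟩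
      f 𝟎              ≈⟨ 𝟎-homo ⟩
      𝟎                ∎)

    sum-homo : ∀ {m} (g : Fin m → Term k X) → f (sum k g) ~ sum k (f ∘ g)
    sum-homo {zero}  g = 𝟎-homo
    sum-homo {suc m} g = trans' (⊕-homo _ _) (⊕-cong refl' (sum-homo (g ∘ suc)))

  ●-additive : ∀ c → IsAdditive (c ●_)
  ●-additive c = record { ~-cong = ●-cong ≈ₖ-refl ; ⊕-homo = ●-distribˡ c }

  bracketˡ-additive : ∀ v → IsAdditive ⟦_, v ⟧
  bracketˡ-additive v = record { ~-cong = λ e → br-cong e refl' ; ⊕-homo = λ u w → br-⊕ˡ u w v }

  bracketʳ-additive : ∀ u → IsAdditive ⟦ u ,_⟧
  bracketʳ-additive u = record { ~-cong = br-cong refl' ; ⊕-homo = br-⊕ʳ u }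

  ●-zeroʳ : ∀ c → (c ● 𝟎) ~ 𝟎
  ●-zeroʳ c = IsAdditive.𝟎-homo (●-additive c)

  br-zeroˡ : ∀ v → ⟦ 𝟎 , v ⟧ ~ 𝟎
  br-zeroˡ v = IsAdditive.𝟎-homo (bracketˡ-additive v)

  br-zeroʳ : ∀ u → ⟦ u , 𝟎 ⟧ ~ 𝟎
  br-zeroʳ u = IsAdditive.𝟎-homo (bracketʳ-additive u)

  ●-zeroˡ : ∀ u → (0ₖ ● u) ~ 𝟎
  ●-zeroˡ u = identityʳ-unique (0ₖ ● u) (0ₖ ● u) (begin
    (0ₖ ● u) ⊕ (0ₖ ● u)  ≈⟨ ●-distribʳ 0ₖ 0ₖ u ⟨
    (0ₖ +ₖ 0ₖ) ● u       ≈⟨ ●-cong (+-identityˡ 0ₖ) refl' ⟩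
    0ₖ ● u               ∎)

  neg≈-1● : ∀ u → neg u ~ ((- 1ₖ) ● u)
  neg≈-1● u = sym' (inverseʳ-unique u ((- 1ₖ) ● u) (begin
    u ⊕ ((- 1ₖ) ● u)          ≈⟨ ⊕-cong (●-id u) refl' ⟨
    (1ₖ ● u) ⊕ ((- 1ₖ) ● u)   ≈⟨ ●-distribʳ 1ₖ (- 1ₖ) u ⟨
    (1ₖ +ₖ (- 1ₖ)) ● u        ≈⟨ ●-cong (-‿inverseʳ 1ₖ) refl' ⟩
    0ₖ ● u                    ≈⟨ ●-zeroˡ u ⟩
    𝟎                         ∎))

  br-anticomm : ∀ u v → ⟦ v , u ⟧ ~ neg ⟦ u , v ⟧
  br-anticomm u v = inverseʳ-unique ⟦ u , v ⟧ ⟦ v , u ⟧ (begin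
    ⟦ u , v ⟧ ⊕ ⟦ v , u ⟧                                ≈⟨ ⊕-cong (⊕-idˡ _) (identityʳ _) ⟨
    (𝟎 ⊕ ⟦ u , v ⟧) ⊕ (⟦ v , u ⟧ ⊕ 𝟎)                    ≈⟨ ⊕-cong (⊕-cong (alt u) refl') (⊕-cong refl' (alt v)) ⟨
    (⟦ u , u ⟧ ⊕ ⟦ u , v ⟧) ⊕ (⟦ v , u ⟧ ⊕ ⟦ v , v ⟧)    ≈⟨ ⊕-cong (br-⊕ʳ u u v) (br-⊕ʳ v u v) ⟨
    ⟦ u , u ⊕ v ⟧ ⊕ ⟦ v , u ⊕ v ⟧                        ≈⟨ br-⊕ˡ u v (u ⊕ v) ⟨
    ⟦ u ⊕ v , u ⊕ v ⟧                                    ≈⟨ alt (u ⊕ v) ⟩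
    𝟎                                                    ∎)

  ad-bracket : ∀ a b s → ⟦ ⟦ a , b ⟧ , s ⟧ ~ (⟦ a , ⟦ b , s ⟧ ⟧ ⊕ neg ⟦ b , ⟦ a , s ⟧ ⟧)
  ad-bracket a b s = begin
    ⟦ ⟦ a , b ⟧ , s ⟧                            ≈⟨ br-anticomm s ⟦ a , b ⟧ ⟩
    neg ⟦ s , ⟦ a , b ⟧ ⟧                        ≈⟨ neg-cong (inverseʳ-unique _ _ (jacobi a b s)) ⟩
    neg (neg (⟦ a , ⟦ b , s ⟧ ⟧ ⊕ ⟦ b , ⟦ s , a ⟧ ⟧))  ≈⟨ ⁻¹-involutive _ ⟩
    ⟦ a , ⟦ b , s ⟧ ⟧ ⊕ ⟦ b , ⟦ s , a ⟧ ⟧        ≈⟨ ⊕-cong refl' (br-cong refl' (br-anticomm a s)) ⟩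
    ⟦ a , ⟦ b , s ⟧ ⟧ ⊕ ⟦ b , neg ⟦ a , s ⟧ ⟧    ≈⟨ ⊕-cong refl' (IsAdditive.neg-homo (bracketʳ-additive b) _) ⟩
    ⟦ a , ⟦ b , s ⟧ ⟧ ⊕ neg ⟦ b , ⟦ a , s ⟧ ⟧    ∎

  record IsSubspace (P : Term k X → Set) : Set where
    field
      resp : ∀ {u v} → u ~ v → P v → P u
      𝟎∈   : P 𝟎
      ⊕∈   : ∀ {u v} → P u → P v → P (u ⊕ v)
      ●∈   : ∀ c {u} → P u → P (c ● u)

    neg∈ : ∀ {u} → P u → P (neg u)
    neg∈ {u} p = resp (neg≈-1● u) (●∈ (- 1ₖ) p)

    sum∈ : ∀ {m} (g : Fin m → Term k X) → (∀ i → P (g i)) → P (sum k g)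
    sum∈ {zero}  g p = 𝟎∈
    sum∈ {suc m} g p = ⊕∈ (p zero) (sum∈ (g ∘ suc) (p ∘ suc))

  open IsSubspace

  ⋂-isSubspace : {I : Set} {P : I → Term k X → Set} → (∀ i → IsSubspace (P i)) →
    IsSubspace (λ u → ∀ i → P i u)
  ⋂-isSubspace sub = record
    { resp = λ e p i → resp (sub i) e (p i)
    ; 𝟎∈   = λ i → 𝟎∈ (sub i)
    ; ⊕∈   = λ p q i → ⊕∈ (sub i) (p i) (q i)
    ; ●∈   = λ c p i → ●∈ (sub i) c (p i) }

  preimage-isSubspace : ∀ {P f} → IsSubspace P → IsAdditive f → (∀ c u → f (c ● u) ~ (c ● f u)) →
    IsSubspace (P ∘ f)
  preimage-isSubspace sub f-additive ●-homo = record
    { resp = λ e → resp sub (~-cong e)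
    ; 𝟎∈   = resp sub 𝟎-homo (𝟎∈ sub)
    ; ⊕∈   = λ p q → resp sub (⊕-homo _ _) (⊕∈ sub p q)
    ; ●∈   = λ c p → resp sub (●-homo c _) (●∈ sub c p) }
    where open IsAdditive f-additive

  term-induction : ∀ {P} → IsSubspace P → (∀ x → P (gen x)) →
    (∀ a b → P a → P b → P ⟦ a , b ⟧) → ∀ a → P a
  term-induction {P} sub gen∈ br∈ = go
    where
    go : ∀ a → P a
    go (gen x)   = gen∈ x
    go 𝟎         = 𝟎∈ sub
    go (a ⊕ b)   = ⊕∈ sub (go a) (go b)
    go (neg a)   = neg∈ sub (go a)
    go (c ● a)   = ●∈ sub c (go a)
    go ⟦ a , b ⟧ = br∈ a b (go a) (go b)

  ~𝟎-isSubspace : IsSubspace (_~ 𝟎)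
  ~𝟎-isSubspace = record
    { resp = trans'
    ; 𝟎∈   = refl'
    ; ⊕∈   = λ p q → trans' (⊕-cong p q) (⊕-idˡ 𝟎)
    ; ●∈   = λ c p → trans' (●-cong ≈ₖ-refl p) (●-zeroʳ c) }

  derived-isSubspace : IsSubspace (Derived k Rl)
  derived-isSubspace = record
    { resp = λ { e (ps , p) → ps , trans' e p }
    ; 𝟎∈   = [] , refl'
    ; ⊕∈   = λ { (ps , p) (qs , q) → ps ++ qs , trans' (⊕-cong p q) (sym' (sumBr-++ ps qs)) }
    ; ●∈   = λ { c (ps , p) → scaleˡ c ps , trans' (●-cong ≈ₖ-refl p) (sym' (sumBr-scaleˡ c ps)) } }
    where
    sumBr-++ : ∀ ps qs → sumBr k (ps ++ qs) ~ (sumBr k ps ⊕ sumBr k qs)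
    sumBr-++ []             qs = sym' (⊕-idˡ _)
    sumBr-++ ((a , b) ∷ ps) qs = trans' (⊕-cong refl' (sumBr-++ ps qs)) (sym' (⊕-assoc _ _ _))

    scaleˡ : K → List (Term k X × Term k X) → List (Term k X × Term k X)
    scaleˡ c []             = []
    scaleˡ c ((a , b) ∷ ps) = (c ● a , b) ∷ scaleˡ c ps

    sumBr-scaleˡ : ∀ c ps → sumBr k (scaleˡ c ps) ~ (c ● sumBr k ps)
    sumBr-scaleˡ c []             = sym' (●-zeroʳ c)
    sumBr-scaleˡ c ((a , b) ∷ ps) =
      trans' (⊕-cong (br-●ˡ c a b) (sumBr-scaleˡ c ps)) (sym' (●-distribˡ c _ _))

  bracket∈derived : ∀ a b → Derived k Rl ⟦ a , b ⟧
  bracket∈derived a b = ((a , b) ∷ []) , sym' (identityʳ _)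

  module _ {P : Term k X → Set} (sub : IsSubspace P) where

    bracketˡ-preimage : ∀ v → IsSubspace (λ u → P ⟦ u , v ⟧)
    bracketˡ-preimage v = preimage-isSubspace sub (bracketˡ-additive v) (λ c u → br-●ˡ c u v)

    bracketʳ-preimage : ∀ u → IsSubspace (λ v → P ⟦ u , v ⟧)
    bracketʳ-preimage u = preimage-isSubspace sub (bracketʳ-additive u) (λ c v → br-●ʳ c u v)

    module _ (gen-stable : ∀ x {s} → P s → P ⟦ gen x , s ⟧) where

      ad-stable : ∀ a {s} → P s → P ⟦ a , s ⟧
      ad-stable a {s} p = term-induction stable-sub (λ x (_ , q) → gen-stable x q) bracket-stable a (s , p)
        where
        Stable : Term k X → Set
        Stable a = (s : Σ (Term k X) P) → P ⟦ a , proj₁ s ⟧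

        stable-sub : IsSubspace Stable
        stable-sub = ⋂-isSubspace (λ s → bracketˡ-preimage (proj₁ s))

        bracket-stable : ∀ a b → Stable a → Stable b → Stable ⟦ a , b ⟧
        bracket-stable a b sa sb (s , q) =
          resp sub (ad-bracket a b s) (⊕∈ sub (sa (_ , sb (s , q))) (neg∈ sub (sb (_ , sa (s , q)))))

      module _ (gen-brackets : ∀ x y → P ⟦ gen x , gen y ⟧) where

        brackets∈ : ∀ a b → P ⟦ a , b ⟧
        brackets∈ a b = term-induction (⋂-isSubspace bracketʳ-preimage) bracket-gen
          (λ b₁ b₂ _ p₂ a → ad-stable a (p₂ b₁)) b a
          where
          bracket-gen : ∀ y a → P ⟦ a , gen y ⟧
          bracket-gen y = term-induction (bracketˡ-preimage (gen y)) (λ x → gen-brackets x y)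
            (λ a b pa pb → resp sub (ad-bracket a b (gen y)) (⊕∈ sub (ad-stable a pb) (neg∈ sub (ad-stable b pa))))

        derived⊆ : ∀ {u} → Derived k Rl u → P u
        derived⊆ (ps , u~ps) = resp sub u~ps (sumBr∈ ps)
          where
          sumBr∈ : ∀ ps → P (sumBr k ps)
          sumBr∈ []             = 𝟎∈ sub
          sumBr∈ ((a , b) ∷ ps) = ⊕∈ sub (brackets∈ a b) (sumBr∈ ps)

  derived~𝟎 : (∀ x y → ⟦ gen x , gen y ⟧ ~ 𝟎) → ∀ {u} → Derived k Rl u → u ~ 𝟎
  derived~𝟎 = derived⊆ ~𝟎-isSubspace (λ x s~𝟎 → trans' (br-cong refl' s~𝟎) (br-zeroʳ _))

  sum~𝟎 : ∀ {m} (g : Fin m → Term k X) → (∀ i → g i ~ 𝟎) → sum k g ~ 𝟎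
  sum~𝟎 = sum∈ ~𝟎-isSubspace

  sum-single : ∀ {m} (g : Fin m → Term k X) i → (∀ j → j ≢ i → g j ~ 𝟎) → sum k g ~ g i
  sum-single {suc m} g i g~𝟎 = begin
    sum k g                        ≈⟨ sum-remove g ⟩
    g i ⊕ sum k (g ∘ punchIn i)    ≈⟨ ⊕-cong refl' (sum~𝟎 _ (λ j → g~𝟎 _ (punchInᵢ≢i i j))) ⟩
    g i ⊕ 𝟎                      ≈⟨ identityʳ (g i) ⟩
    g i                          ∎

module Substitution (k : Field) where

  subst-cong : ∀ {X Y} {Rl : Term k X → Set} {Rl′ : Term k Y → Set} (f : X → Term k Y) →
    (∀ {r} → Rl r → Eq k Rl′ (subst k f r) 𝟎) →
    ∀ {u v} → Eq k Rl u v → Eq k Rl′ (subst k f u) (subst k f v)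
  subst-cong f rel↦𝟎 = go
    where
    go : ∀ {u v} → Eq k _ u v → Eq k _ (subst k f u) (subst k f v)
    go refl'              = refl'
    go (sym' e)           = sym' (go e)
    go (trans' e e′)      = trans' (go e) (go e′)
    go (⊕-cong e e′)      = ⊕-cong (go e) (go e′)
    go (neg-cong e)       = neg-cong (go e)
    go (●-cong a≈b e)     = ●-cong a≈b (go e)
    go (br-cong e e′)     = br-cong (go e) (go e′)
    go (⊕-assoc u v w)    = ⊕-assoc _ _ _
    go (⊕-comm u v)       = ⊕-comm _ _
    go (⊕-idˡ u)          = ⊕-idˡ _
    go (⊕-invʳ u)         = ⊕-invʳ _
    go (●-distribˡ a u v) = ●-distribˡ a _ _
    go (●-distribʳ a b u) = ●-distribʳ a b _
    go (●-assoc a b u)    = ●-assoc a b _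
    go (●-id u)           = ●-id _
    go (br-⊕ˡ u v w)      = br-⊕ˡ _ _ _
    go (br-⊕ʳ u v w)      = br-⊕ʳ _ _ _
    go (br-●ˡ a u v)      = br-●ˡ a _ _
    go (br-●ʳ a u v)      = br-●ʳ a _ _
    go (alt u)            = alt _
    go (jacobi u v w)     = jacobi _ _ _
    go (rel r)            = rel↦𝟎 r

  subst-∘ : ∀ {X Y Z} (f : Y → Term k Z) (g : X → Term k Y) t →
    subst k f (subst k g t) ≡ subst k (subst k f ∘ g) t
  subst-∘ f g (gen x)   = refl
  subst-∘ f g 𝟎         = refl
  subst-∘ f g (t ⊕ u)   = cong₂ _⊕_ (subst-∘ f g t) (subst-∘ f g u)
  subst-∘ f g (neg t)   = cong neg (subst-∘ f g t)
  subst-∘ f g (c ● t)   = cong (c ●_) (subst-∘ f g t)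
  subst-∘ f g ⟦ t , u ⟧ = cong₂ ⟦_,_⟧ (subst-∘ f g t) (subst-∘ f g u)

  subst-gen : ∀ {X} {f : X → Term k X} → (∀ x → f x ≡ gen x) → ∀ t → subst k f t ≡ t
  subst-gen f≗gen (gen x)   = f≗gen x
  subst-gen f≗gen 𝟎         = refl
  subst-gen f≗gen (t ⊕ u)   = cong₂ _⊕_ (subst-gen f≗gen t) (subst-gen f≗gen u)
  subst-gen f≗gen (neg t)   = cong neg (subst-gen f≗gen t)
  subst-gen f≗gen (c ● t)   = cong (c ●_) (subst-gen f≗gen t)
  subst-gen f≗gen ⟦ t , u ⟧ = cong₂ ⟦_,_⟧ (subst-gen f≗gen t) (subst-gen f≗gen u)

  subst-sum : ∀ {X Y m} (f : X → Term k Y) (g : Fin m → Term k X) →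
    subst k f (sum k g) ≡ sum k (subst k f ∘ g)
  subst-sum {m = zero}  f g = refl
  subst-sum {m = suc m} f g = cong (subst k f (g zero) ⊕_) (subst-sum f (g ∘ suc))

  data GeneratorCommutator {X : Set} : Term k X → Set where
    commutator : ∀ x y → GeneratorCommutator ⟦ gen x , gen y ⟧

  subst-derived~𝟎 : ∀ {X Y} {Rl : Term k X → Set} {Rl′ : Term k Y → Set} (f : X → Term k Y) →
    (∀ x y → Eq k Rl′ ⟦ f x , f y ⟧ 𝟎) → (∀ {r} → Rl r → Eq k Rl′ (subst k f r) 𝟎) →
    ∀ {t} → Derived k Rl t → Eq k Rl′ (subst k f t) 𝟎
  -- subst k f factors through the free abelian Lie algebra on X, where derived elements vanish.
  subst-derived~𝟎 f images-commute rel↦𝟎 (ps , t~ps) =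
    trans' (subst-cong f rel↦𝟎 t~ps)
           (subst-cong f (λ { (commutator x y) → images-commute x y }) ps~𝟎)
    where
    ps~𝟎 = Presentation.derived~𝟎 k GeneratorCommutator (λ x y → rel (commutator x y)) (ps , refl')

module Arrangement (k : Field) {n m : ℕ} (A : Fin m → Subset n)
  (RA : (i : Fin m) → Term k (Gen k (A i)) → Set) where

  open Substitution k

  R : Term k (Fin n) → Set
  R = BigR k A RA

  module 𝓛 = Presentation k R
  module L (i : Fin m) = Presentation k (RA i)
  module Derivedᵢ (i : Fin m) = L.IsSubspace i (L.derived-isSubspace i)
  open 𝓛 using (_~_)

  π : ∀ i → Term k (Fin n) → Term k (Gen k (A i))
  π i = πMap k (A i)

  s : ∀ i → Term k (Gen k (A i)) → Term k (Fin n)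
  s i = sMap k (A i)

  π-gen-∈ : ∀ i {x} (x∈Aᵢ : x ∈ A i) → π i (gen x) ≡ gen (x , x∈Aᵢ)
  π-gen-∈ i {x} x∈Aᵢ with x ∈? A i
  ... | yes x∈Aᵢ′ = cong (λ p → gen (x , p)) ([]=-irrelevant x∈Aᵢ′ x∈Aᵢ)
  ... | no x∉Aᵢ   = contradiction x∈Aᵢ x∉Aᵢ

  π-gen-∉ : ∀ i {x} → x ∉ A i → π i (gen x) ≡ 𝟎
  π-gen-∉ i {x} x∉Aᵢ with x ∈? A i
  ... | yes x∈Aᵢ = contradiction x∈Aᵢ x∉Aᵢ
  ... | no _     = refl

  π∘s-self : ∀ i t → π i (s i t) ≡ t
  π∘s-self i t = trans (subst-∘ _ _ t) (subst-gen (λ (_ , x∈Aᵢ) → π-gen-∈ i x∈Aᵢ) t)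

  π-bracket-gen : ∀ j {x y} → ¬ (x ∈ A j × y ∈ A j) → Eq k (RA j) ⟦ π j (gen x) , π j (gen y) ⟧ 𝟎
  π-bracket-gen j {x} {y} ¬both with x ∈? A j | y ∈? A j -- the decision by which π j (gen _) computes
  ... | yes x∈Aⱼ | yes y∈Aⱼ = contradiction (x∈Aⱼ , y∈Aⱼ) ¬both
  ... | no _     | _        = L.br-zeroˡ j _
  ... | yes _    | no _     = L.br-zeroʳ j _

  KernelTrivial : Set
  KernelTrivial = ∀ u → Derived k R u → (∀ i → Eq k (RA i) (π i u) 𝟎) → u ~ 𝟎

  OutsideGeneratorsCentralize : Set
  OutsideGeneratorsCentralize = ∀ i x → x ∉ A i → ∀ v → Derived k (RA i) v → ⟦ gen x , s i v ⟧ ~ 𝟎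

  s-cong : ∀ i {u v} → Eq k (RA i) u v → s i u ~ s i v
  s-cong i = subst-cong _ λ r∈RAᵢ → rel (fromA i _ r∈RAᵢ)

  Family : Set
  Family = (i : Fin m) → Term k (Gen k (A i))

  sumImages : Family → Term k (Fin n)
  sumImages w = sum k (λ i → s i (w i))

  InSumOfImages : Term k (Fin n) → Set
  InSumOfImages u = Σ Family λ w → (∀ i → Derived k (RA i) (w i)) × (u ~ sumImages w)

  sumOfImages-isSubspace : 𝓛.IsSubspace InSumOfImages
  sumOfImages-isSubspace = record
    { resp = λ { e (w , dw , u~) → w , dw , trans' e u~ }
    ; 𝟎∈   = (λ _ → 𝟎) , Derivedᵢ.𝟎∈ , sym' (𝓛.sum~𝟎 (λ i → s i 𝟎) λ _ → refl')
    ; ⊕∈   = λ { (w , dw , u~) (w′ , dw′ , v~) →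
               (λ i → w i ⊕ w′ i) , (λ i → Derivedᵢ.⊕∈ i (dw i) (dw′ i)) ,
               trans' (⊕-cong u~ v~) (sym' (𝓛.∑-distrib-+ (λ i → s i (w i)) (λ i → s i (w′ i)))) }
    ; ●∈   = λ { c (w , dw , u~) →
               (λ i → c ● w i) , (λ i → Derivedᵢ.●∈ i c (dw i)) ,
               trans' (●-cong (Field.refl k) u~)
                      (𝓛.IsAdditive.sum-homo (𝓛.●-additive c) (λ i → s i (w i))) } }

  module SumOfImages = 𝓛.IsSubspace sumOfImages-isSubspace

  single : ∀ i → Term k (Gen k (A i)) → Family
  single i t j with i ≟ j
  ... | yes refl = t
  ... | no _     = 𝟎

  s∈sumOfImages : ∀ i {t} → Derived k (RA i) t → InSumOfImages (s i t)
  s∈sumOfImages i {t} d = single i t , single-derived , sym' (trans' (𝓛.sum-single _ i off-diagonal) diagonal)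
    where
    single-derived : ∀ j → Derived k (RA j) (single i t j)
    single-derived j with i ≟ j
    ... | yes refl = d
    ... | no _     = Derivedᵢ.𝟎∈ j

    off-diagonal : ∀ j → j ≢ i → s j (single i t j) ~ 𝟎
    off-diagonal j j≢i with i ≟ j
    ... | yes refl = contradiction refl j≢i
    ... | no _     = refl'

    diagonal : s i (single i t i) ~ s i t
    diagonal with i ≟ i
    ... | yes refl = refl'
    ... | no i≢i   = contradiction refl i≢i

  sumOfImages-gen-brackets : ∀ x y → InSumOfImages ⟦ gen x , gen y ⟧
  sumOfImages-gen-brackets x y with any? (λ i → x ∈? A i ×-dec y ∈? A i)
  ... | yes (i , x∈Aᵢ , y∈Aᵢ) = s∈sumOfImages i (L.bracket∈derived i (gen (x , x∈Aᵢ)) (gen (y , y∈Aᵢ)))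
  ... | no not-together      = SumOfImages.resp (rel (pairs x y not-together)) SumOfImages.𝟎∈

  module _ (centralize : OutsideGeneratorsCentralize) where

    bracket-gen-s : ∀ x i {t} → Derived k (RA i) t → ⟦ gen x , s i t ⟧ ~ s i ⟦ π i (gen x) , t ⟧
    bracket-gen-s x i {t} d with x ∈? A i
    ... | yes _    = refl'
    ... | no x∉Aᵢ  = trans' (centralize i x x∉Aᵢ t d) (sym' (𝓛.br-zeroˡ _))

    sumOfImages-gen-stable : ∀ x {u} → InSumOfImages u → InSumOfImages ⟦ gen x , u ⟧
    sumOfImages-gen-stable x {u} (w , dw , u~) =
      (λ i → ⟦ π i (gen x) , w i ⟧) , (λ i → L.bracket∈derived i _ _) , (begin
        ⟦ gen x , u ⟧                            ≈⟨ br-cong refl' u~ ⟩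
        ⟦ gen x , sumImages w ⟧                  ≈⟨ sum-homo (λ i → s i (w i)) ⟩
        sum k (λ i → ⟦ gen x , s i (w i) ⟧)      ≈⟨ 𝓛.sum-cong-≋ (λ i → bracket-gen-s x i (dw i)) ⟩
        sumImages (λ i → ⟦ π i (gen x) , w i ⟧)  ∎)
      where
      open SetoidReasoning 𝓛.setoid
      open 𝓛.IsAdditive (𝓛.bracketʳ-additive (gen x)) using (sum-homo)

    derived⊆sumOfImages : ∀ {u} → Derived k R u → InSumOfImages u
    derived⊆sumOfImages =
      𝓛.derived⊆ sumOfImages-isSubspace sumOfImages-gen-stable sumOfImages-gen-brackets

  module _ (small-intersections : ∀ i j → i ≢ j → ∣ A i ∩ A j ∣ ≤ 1)
           (RA-derived : ∀ i r → RA i r → Derived k (NoRel k) r) where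

    π∘s-generators-commute : ∀ {i j} → i ≢ j → ∀ {x y} → x ∈ A i → y ∈ A i →
      Eq k (RA j) ⟦ π j (gen x) , π j (gen y) ⟧ 𝟎
    π∘s-generators-commute {i} {j} i≢j {x} {y} x∈Aᵢ y∈Aᵢ with x ≟ y
    ... | yes refl = alt _
    ... | no x≢y   = π-bracket-gen j λ (x∈Aⱼ , y∈Aⱼ) → x≢y (x∈p∧y∈p∧∣p∣≤1⇒x≡y
            (x∈p∩q⁺ (x∈Aᵢ , x∈Aⱼ)) (x∈p∩q⁺ (y∈Aᵢ , y∈Aⱼ)) (small-intersections i j i≢j))

    π∘s-cross~𝟎 : ∀ {i j} → i ≢ j → {Rl : Term k (Gen k (A i)) → Set} →
      (∀ {r} → Rl r → Eq k (RA j) (π j (s i r)) 𝟎) →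
      ∀ {t} → Derived k Rl t → Eq k (RA j) (π j (s i t)) 𝟎
    π∘s-cross~𝟎 {i} {j} i≢j rel↦𝟎 {t} d =
      trans' (L.reflexive j (subst-∘ _ _ t))
        (subst-derived~𝟎 _ (λ (_ , x∈Aᵢ) (_ , y∈Aᵢ) → π∘s-generators-commute i≢j x∈Aᵢ y∈Aᵢ)
          (λ {r} r∈Rl → trans' (L.reflexive j (sym (subst-∘ _ _ r))) (rel↦𝟎 r∈Rl)) d)

    π∘s-cross-free : ∀ {i j} → i ≢ j → ∀ {t} → Derived k (NoRel k) t → Eq k (RA j) (π j (s i t)) 𝟎
    π∘s-cross-free i≢j = π∘s-cross~𝟎 i≢j λ ()

    π∘s-cross : ∀ {i j} → i ≢ j → ∀ {t} → Derived k (RA i) t → Eq k (RA j) (π j (s i t)) 𝟎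
    π∘s-cross i≢j = π∘s-cross~𝟎 i≢j λ {r} r∈RAᵢ → π∘s-cross-free i≢j (RA-derived _ r r∈RAᵢ)

    π-kills-R : ∀ j {r} → R r → Eq k (RA j) (π j r) 𝟎
    π-kills-R j (fromA i r r∈RAᵢ) with i ≟ j
    ... | yes refl = trans' (L.reflexive i (π∘s-self i r)) (rel r∈RAᵢ)
    ... | no i≢j   = π∘s-cross-free i≢j (RA-derived i r r∈RAᵢ)
    π-kills-R j (pairs x y not-together) = π-bracket-gen j λ (x∈Aⱼ , y∈Aⱼ) → not-together (j , x∈Aⱼ , y∈Aⱼ)

    π-cong : ∀ j {u v} → u ~ v → Eq k (RA j) (π j u) (π j v)
    π-cong j = subst-cong _ (π-kills-R j)

    π-sumImages : ∀ {w} → (∀ i → Derived k (RA i) (w i)) → ∀ j → Eq k (RA j) (π j (sumImages w)) (w j)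
    π-sumImages {w} dw j = begin
      π j (sumImages w)                ≡⟨ subst-sum _ (λ i → s i (w i)) ⟩
      sum k (λ i → π j (s i (w i)))    ≈⟨ L.sum-single j _ j (λ i i≢j → π∘s-cross i≢j (dw i)) ⟩
      π j (s j (w j))                  ≡⟨ π∘s-self j (w j) ⟩
      w j                              ∎
      where open SetoidReasoning (L.setoid j)

    kernelTrivial⇒centralize : KernelTrivial → OutsideGeneratorsCentralize
    kernelTrivial⇒centralize trivial i x x∉Aᵢ v dv = trivial _ (𝓛.bracket∈derived _ _) π-vanishes
      where
      π-vanishes : ∀ j → Eq k (RA j) (π j ⟦ gen x , s i v ⟧) 𝟎
      π-vanishes j with i ≟ j
      ... | yes refl = trans' (br-cong (L.reflexive i (π-gen-∉ i x∉Aᵢ)) refl') (L.br-zeroˡ i _)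
      ... | no i≢j   = trans' (br-cong refl' (π∘s-cross i≢j dv)) (L.br-zeroʳ j _)

    centralize⇒kernelTrivial : OutsideGeneratorsCentralize → KernelTrivial
    centralize⇒kernelTrivial centralize u du π-vanishes =
      let w , dw , u~sum = derived⊆sumOfImages centralize du
          wⱼ~𝟎 : ∀ j → Eq k (RA j) (w j) 𝟎
          wⱼ~𝟎 j = trans' (sym' (π-sumImages dw j)) (trans' (sym' (π-cong j u~sum)) (π-vanishes j))
      in trans' u~sum (𝓛.sum~𝟎 _ λ j → s-cong j (wⱼ~𝟎 j))

mainTheorem2 : (k : Field) (n m : ℕ) (A : Fin m → Subset n) → IsSetArrangement k A →
    (RA : (i : Fin m) → Term k (Gen k (A i)) → Set) →
    (∀ i r → RA i r → Derived k (NoRel k) r) →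
    ((∀ u → Derived k (BigR k A RA) u →
        (∀ i → Eq k (RA i) (πMap k (A i) u) (𝟎)) → Eq k (BigR k A RA) u (𝟎))
     ⇔
     (∀ i x → x ∉ A i → ∀ v → Derived k (RA i) v →
        Eq k (BigR k A RA) (⟦_,_⟧ (gen x) (sMap k (A i) v)) (𝟎)))
mainTheorem2 k n m A (_ , small-intersections) RA RA-derived =
  mk⇔ (kernelTrivial⇒centralize small-intersections RA-derived)
      (centralize⇒kernelTrivial small-intersections RA-derived)
  where open Arrangement k A RA
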